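{- When DLM finishes reordering its list in any step, $b(z)<\pi(z)$ for every element $z\in\mathcal U$. Moreover, $b(z)<\tfrac32\,\pi(z)$ holds for every element $z$ at all times, including during list reordering.
   Context: Online Min-Sum Set Cover: a list (permutation $\pi:\mathcal U\to\{1,\dots,n\}$ of a universe $\mathcal U$ of $n$ elements) is maintained, and requests are nonempty subsets $R\subseteq\mathcal U$. Algorithm DLM. Every element $z$ has a budget $b(z)$, initially $0$, and $\pi(z)$ denotes its current position. The operation fetch$(z)$ moves $z$ to position 1 by $\pi(z)-1$ adjacent swaps, so every element that preceded $z$ moves back by one position, and then sets $b(z)\gets0$. On a request $R$ with $|R|=s$, let $x\in R$ be the element of $R$ with the smallest current position and let $\ell=\pi(x)$. DLM pays access cost $\ell$ and executes fetch$(x)$. For every $y\in R\setminus\{x\}$ it sets $b(y)\gets b(y)+\ell/s$. Finally, while some element $z$ has $b(z)\ge\pi(z)$, it executes fetch$(z)$ for such a $z$. -}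

module Defs where

open import Data.Nat using (ℕ; zero; suc; NonZero; >-nonZero; z<s; s<s)
import Data.Nat as ℕ
open import Data.Nat.Properties using (≤-<-trans; n≤0⇒n≡0)
open import Data.Fin using (Fin; _≟_)
open import Data.Fin.Subset using (Subset; _∈_; _∉_; ∣_∣)
open import Data.Fin.Subset.Properties using (x∈p⇒∣p-x∣<∣p∣; _∈?_)
open import Data.List using (List; []; _∷_; allFin)
open import Data.List.Relation.Binary.Permutation.Propositional using (_↭_)
open import Data.Integer using (+_)
open import Data.Rational using (ℚ; 0ℚ; _/_; _+_; _*_; _≤_; _<_)
open import Relation.Nullary using (yes; no)
open import Relation.Binary.PropositionalEquality using (_≡_)

-- The universe U is Fin n.  The list is a List (Fin n) (a permutation of allFin n).

-- π(z): 1-based position of (the first occurrence of) z in the list.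
pos : ∀ {n} → List (Fin n) → Fin n → ℕ
pos []       z = 0
pos (y ∷ ys) z with y ≟ z
... | yes _ = 1
... | no  _ = suc (pos ys z)

remove : ∀ {n} → Fin n → List (Fin n) → List (Fin n)
remove z []       = []
remove z (y ∷ ys) with y ≟ z
... | yes _ = ys
... | no  _ = y ∷ remove z ys

fetchList : ∀ {n} → Fin n → List (Fin n) → List (Fin n)
fetchList z L = z ∷ remove z L

ℕ→ℚ : ℕ → ℚ
ℕ→ℚ k = + k / 1

Budget : ℕ → Set
Budget n = Fin n → ℚ

resetB : ∀ {n} → Fin n → Budget n → Budget n
resetB z b w with w ≟ z
... | yes _ = 0ℚ
... | no  _ = b w

∈⇒nonZero : ∀ {n} {x : Fin n} {R : Subset n} → x ∈ R → NonZero ∣ R ∣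
∈⇒nonZero {x = x} {R} x∈R = >-nonZero (≤-<-trans ℕ.z≤n (x∈p⇒∣p-x∣<∣p∣ x∈R))

share : ∀ {n} {x : Fin n} (R : Subset n) → x ∈ R → ℕ → ℚ
share R x∈R ℓ = (+ ℓ / ∣ R ∣) {{∈⇒nonZero x∈R}}

incrB : ∀ {n} (R : Subset n) (x : Fin n) → ℚ → Budget n → Budget n
incrB R x δ b y with y ≟ x | y ∈? R
... | yes _ | _     = b y
... | no  _ | yes _ = b y + δ
... | no  _ | no  _ = b y

-- Phases of DLM:
--   idle       : a request has been fully served (reordering finished), or initial state
--   accessed   : x has been fetched for the current request, budgets not yet increased
--   reordering : inside the while loop
data Phase (n : ℕ) : Set where
  idle       : Phase n
  accessed   : (R : Subset n) (x : Fin n) → x ∈ R → (ℓ : ℕ) → Phase n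
  reordering : Phase n

-- States reachable by DLM from the initial list L0 (all budgets 0), at the
-- granularity of whole fetch operations.  Nondeterministic choice in the
-- while loop is modelled by allowing any z with b(z) ≥ π(z).
data Reachable {n : ℕ} (L0 : List (Fin n)) : Phase n → List (Fin n) → Budget n → Set where
  init    : Reachable L0 idle L0 (λ _ → 0ℚ)
  request : ∀ {L b} (R : Subset n) (x : Fin n) (x∈R : x ∈ R) →
            (∀ y → y ∈ R → pos L x ℕ.≤ pos L y) →
            Reachable L0 idle L b →
            Reachable L0 (accessed R x x∈R (pos L x)) (fetchList x L) (resetB x b)
  budgets : ∀ {L b R x x∈R ℓ} →
            Reachable L0 (accessed R x x∈R ℓ) L b →
            Reachable L0 reordering L (incrB R x (share R x∈R ℓ) b)
  reorder : ∀ {L b} (z : Fin n) → ℕ→ℚ (pos L z) ≤ b z →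
            Reachable L0 reordering L b →
            Reachable L0 reordering (fetchList z L) (resetB z b)
  finish  : ∀ {L b} → (∀ z → b z < ℕ→ℚ (pos L z)) →
            Reachable L0 reordering L b →
            Reachable L0 idle L b

{-# OPTIONS --safe #-}
module Submission where

-- Every budget b(y) is raised only when another element x of the same request R
-- is accessed at position ℓ = π(x).  Then y lies strictly behind x, so ℓ < π(y),
-- and s = |R| ≥ 2, so the increment ℓ/s is below π(y)/2.  Just before the
-- increment b(y) < π(y): the previous reordering ended with all budgets below
-- the positions, and fetch(x) resets b(x) and moves no other element forward.
-- Hence b(y) < 3/2·π(y) after the increment; the fetches of the reordering loop
-- preserve this bound for the same reason, and the loop stops only once every
-- b(z) < π(z).

open import Defs
open import Data.Nat as ℕ using (ℕ; suc; z≤n; s≤s; NonZero)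
import Data.Nat.Properties as ℕₚ
open import Data.Nat.Tactic.RingSolver using (solve-∀)
open import Data.Fin using (Fin; _≟_)
open import Data.Fin.Subset as Subset using (Subset; ∣_∣)
open import Data.Fin.Subset.Properties using (x∈p⇒∣p-x∣<∣p∣; x∈p∧x≢y⇒x∈p-y; _∈?_)
open import Data.List using (List; []; _∷_; allFin)
open import Data.List.Membership.Propositional using (_∈_)
open import Data.List.Membership.Propositional.Properties using (∈-allFin)
open import Data.List.Relation.Unary.Any as Any using (here; there)
open import Data.List.Relation.Binary.Permutation.Propositional using (_↭_; ↭-sym)
open import Data.List.Relation.Binary.Permutation.Propositional.Properties using (∈-resp-↭)
open import Data.Integer as ℤ using (+_)
import Data.Integer.Properties as ℤₚ
open import Data.Rational using (ℚ; 0ℚ; _/_; _+_; _*_; _≤_; _<_; toℚᵘ)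
open import Data.Rational.Properties
  using ( toℚᵘ-fromℚᵘ; toℚᵘ-cancel-≤; toℚᵘ-cancel-<; toℚᵘ-injective; toℚᵘ-homo-+; toℚᵘ-homo-*
        ; <-≤-trans; +-monoˡ-<; module ≤-Reasoning)
import Data.Rational.Unnormalised as ℚᵘ
import Data.Rational.Unnormalised.Properties as ℚᵘₚ
open import Data.Product using (_×_; _,_; proj₂)
open import Data.Empty using (⊥-elim)
open import Function using (_∘_)
open import Relation.Binary.Core using (_Preserves_⟶_)
open import Relation.Binary.PropositionalEquality using (_≡_; _≢_; refl; sym; cong; cong₂; subst; subst₂)
open import Relation.Nullary using (yes; no)

variable
  n : ℕ
  x y z w : Fin n
  L : List (Fin n)

pos-fetchList-self : ∀ (z : Fin n) L → pos (fetchList z L) z ≡ 1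
pos-fetchList-self z L with z ≟ z
... | yes _  = refl
... | no z≢z = ⊥-elim (z≢z refl)

pos-remove : w ≢ z → pos L w ℕ.≤ suc (pos (remove z L) w)
pos-remove {L = []} _ = z≤n
pos-remove {w = w} {z} {L = v ∷ L} w≢z with v ≟ z
pos-remove {w = w} {z} {L = v ∷ L} w≢z | yes refl with v ≟ w
... | yes refl = ⊥-elim (w≢z refl)
... | no _     = ℕₚ.≤-refl
pos-remove {w = w} {z} {L = v ∷ L} w≢z | no _ with v ≟ w
... | yes _ = s≤s z≤n
... | no _  = s≤s (pos-remove {L = L} w≢z)

pos-fetchList-≢ : w ≢ z → pos L w ℕ.≤ pos (fetchList z L) w
pos-fetchList-≢ {w = w} {z} {L} w≢z with z ≟ w
... | yes refl = ⊥-elim (w≢z refl)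
... | no _     = pos-remove {L = L} w≢z

∈-remove : w ≢ z → w ∈ L → w ∈ remove z L
∈-remove {z = z} {L = v ∷ L} w≢z w∈ with v ≟ z
∈-remove w≢z (here refl) | yes refl = ⊥-elim (w≢z refl)
∈-remove w≢z (there w∈) | yes refl = w∈
∈-remove w≢z (here w≡v) | no _     = here w≡v
∈-remove w≢z (there w∈) | no _     = there (∈-remove w≢z w∈)

∈-fetchList : w ∈ L → w ∈ fetchList z L
∈-fetchList {w = w} {z = z} w∈ with w ≟ z
... | yes w≡z = here w≡z
... | no w≢z  = there (∈-remove w≢z w∈)

∈⇒pos>0 : w ∈ L → 0 ℕ.< pos L w
∈⇒pos>0 {w = w} {L = v ∷ L} _ with v ≟ w
... | yes _ = s≤s z≤n
... | no _  = s≤s z≤n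

pos-injective : x ∈ L → y ∈ L → pos L x ≡ pos L y → x ≡ y
pos-injective {x = x} {L = v ∷ L} {y = y} x∈ y∈ eq with v ≟ x | v ≟ y
... | yes refl | yes refl = refl
... | yes refl | no v≢y   =
  ⊥-elim (ℕₚ.<⇒≢ (∈⇒pos>0 (Any.tail (v≢y ∘ sym) y∈)) (ℕₚ.suc-injective eq))
... | no v≢x   | yes refl =
  ⊥-elim (ℕₚ.<⇒≢ (∈⇒pos>0 (Any.tail (v≢x ∘ sym) x∈)) (ℕₚ.suc-injective (sym eq)))
... | no v≢x   | no v≢y   =
  pos-injective (Any.tail (v≢x ∘ sym) x∈) (Any.tail (v≢y ∘ sym) y∈) (ℕₚ.suc-injective eq)

two≤∣R∣ : ∀ {R : Subset n} → x Subset.∈ R → y Subset.∈ R → y ≢ x → 2 ℕ.≤ ∣ R ∣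
two≤∣R∣ x∈R y∈R y≢x = ℕₚ.≤-trans
  (s≤s (ℕₚ.≤-trans (s≤s z≤n) (x∈p⇒∣p-x∣<∣p∣ (x∈p∧x≢y⇒x∈p-y y∈R y≢x))))
  (x∈p⇒∣p-x∣<∣p∣ x∈R)

-- + a / suc c computes to fromℚᵘ (mkℚᵘ (+ a) c).
toℚᵘ-/ : ∀ a c → toℚᵘ (+ a / suc c) ℚᵘ.≃ ℚᵘ.mkℚᵘ (+ a) c
toℚᵘ-/ a c = toℚᵘ-fromℚᵘ (ℚᵘ.mkℚᵘ (+ a) c)

/-mono-≤ : ∀ a b c d → a ℕ.* suc d ℕ.≤ b ℕ.* suc c → + a / suc c ≤ + b / suc d
/-mono-≤ a b c d h = toℚᵘ-cancel-≤
  (ℚᵘₚ.≤-respˡ-≃ (ℚᵘₚ.≃-sym (toℚᵘ-/ a c)) (ℚᵘₚ.≤-respʳ-≃ (ℚᵘₚ.≃-sym (toℚᵘ-/ b d))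
    (ℚᵘ.*≤* (subst₂ ℤ._≤_ (ℤₚ.pos-* a (suc d)) (ℤₚ.pos-* b (suc c)) (ℤ.+≤+ h)))))

/-mono-< : ∀ a b c d → a ℕ.* suc d ℕ.< b ℕ.* suc c → + a / suc c < + b / suc d
/-mono-< a b c d h = toℚᵘ-cancel-<
  (ℚᵘₚ.<-respˡ-≃ (ℚᵘₚ.≃-sym (toℚᵘ-/ a c)) (ℚᵘₚ.<-respʳ-≃ (ℚᵘₚ.≃-sym (toℚᵘ-/ b d))
    (ℚᵘ.*<* (subst₂ ℤ._<_ (ℤₚ.pos-* a (suc d)) (ℤₚ.pos-* b (suc c)) (ℤ.+<+ h)))))

/-+-/ : ∀ a b c d →
        + a / suc c + + b / suc d ≡ + (a ℕ.* suc d ℕ.+ b ℕ.* suc c) / (suc c ℕ.* suc d)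
/-+-/ a b c d = toℚᵘ-injective (ℚᵘₚ.≃-trans (toℚᵘ-homo-+ (+ a / suc c) (+ b / suc d))
  (ℚᵘₚ.≃-trans (ℚᵘₚ.+-cong (toℚᵘ-/ a c) (toℚᵘ-/ b d))
  (ℚᵘₚ.≃-trans (ℚᵘₚ.≃-reflexive numerator)
  (ℚᵘₚ.≃-sym (toℚᵘ-/ (a ℕ.* suc d ℕ.+ b ℕ.* suc c) (d ℕ.+ c ℕ.* suc d))))))
  where
  numerator : ℚᵘ.mkℚᵘ (+ a ℤ.* + suc d ℤ.+ + b ℤ.* + suc c) (d ℕ.+ c ℕ.* suc d)
            ≡ ℚᵘ.mkℚᵘ (+ (a ℕ.* suc d ℕ.+ b ℕ.* suc c)) (d ℕ.+ c ℕ.* suc d)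
  numerator = cong (λ k → ℚᵘ.mkℚᵘ k _)
    (cong₂ ℤ._+_ (sym (ℤₚ.pos-* a (suc d))) (sym (ℤₚ.pos-* b (suc c))))

/-*-/ : ∀ a b c d → (+ a / suc c) * (+ b / suc d) ≡ + (a ℕ.* b) / (suc c ℕ.* suc d)
/-*-/ a b c d = toℚᵘ-injective (ℚᵘₚ.≃-trans (toℚᵘ-homo-* (+ a / suc c) (+ b / suc d))
  (ℚᵘₚ.≃-trans (ℚᵘₚ.*-cong (toℚᵘ-/ a c) (toℚᵘ-/ b d))
  (ℚᵘₚ.≃-trans (ℚᵘₚ.≃-reflexive (cong (λ k → ℚᵘ.mkℚᵘ k _) (sym (ℤₚ.pos-* a b))))
  (ℚᵘₚ.≃-sym (toℚᵘ-/ (a ℕ.* b) (d ℕ.+ c ℕ.* suc d))))))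

ℕ→ℚ-mono-≤ : ℕ→ℚ Preserves ℕ._≤_ ⟶ _≤_
ℕ→ℚ-mono-≤ {a} {b} a≤b = /-mono-≤ a b 0 0 (ℕₚ.*-monoˡ-≤ 1 a≤b)

ℕ→ℚ-pos : ∀ p → 0 ℕ.< p → 0ℚ < ℕ→ℚ p
ℕ→ℚ-pos p 0<p = /-mono-< 0 p 0 0 (ℕₚ.*-monoˡ-< 1 0<p)

three-halves : ℕ → ℚ
three-halves p = (+ 3 / 2) * ℕ→ℚ p

three-halves≡ : ∀ p → three-halves p ≡ + (3 ℕ.* p) / 2
three-halves≡ p = /-*-/ 3 p 1 0

three-halves-mono-≤ : three-halves Preserves ℕ._≤_ ⟶ _≤_
three-halves-mono-≤ {a} {b} a≤b
  rewrite three-halves≡ a | three-halves≡ b =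
  /-mono-≤ (3 ℕ.* a) (3 ℕ.* b) 1 1 (ℕₚ.*-monoˡ-≤ 2 (ℕₚ.*-monoʳ-≤ 3 a≤b))

ℕ→ℚ≤three-halves : ∀ p → ℕ→ℚ p ≤ three-halves p
ℕ→ℚ≤three-halves p rewrite three-halves≡ p = /-mono-≤ p (3 ℕ.* p) 0 1 (begin
  p ℕ.* 2       ≤⟨ ℕₚ.*-monoʳ-≤ p (ℕₚ.n≤1+n 2) ⟩
  p ℕ.* 3       ≡⟨ ℕₚ.*-comm p 3 ⟩
  3 ℕ.* p       ≡⟨ ℕₚ.*-identityʳ (3 ℕ.* p) ⟨
  3 ℕ.* p ℕ.* 1 ∎)
  where open ℕₚ.≤-Reasoning

[pm+ℓ]*2≤3p*m : ∀ {p m ℓ} → ℓ ℕ.≤ p → 2 ℕ.≤ m →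
                (p ℕ.* m ℕ.+ ℓ ℕ.* 1) ℕ.* 2 ℕ.≤ 3 ℕ.* p ℕ.* (1 ℕ.* m)
[pm+ℓ]*2≤3p*m {p} {m} {ℓ} ℓ≤p 2≤m = begin
  (p ℕ.* m ℕ.+ ℓ ℕ.* 1) ℕ.* 2 ≡⟨ expand p m ℓ ⟩
  p ℕ.* m ℕ.* 2 ℕ.+ ℓ ℕ.* 2   ≤⟨ ℕₚ.+-monoʳ-≤ (p ℕ.* m ℕ.* 2) (ℕₚ.*-mono-≤ ℓ≤p 2≤m) ⟩
  p ℕ.* m ℕ.* 2 ℕ.+ p ℕ.* m   ≡⟨ collect p m ⟩
  3 ℕ.* p ℕ.* (1 ℕ.* m)       ∎
  where
  open ℕₚ.≤-Reasoning
  expand : ∀ p m ℓ → (p ℕ.* m ℕ.+ ℓ ℕ.* 1) ℕ.* 2 ≡ p ℕ.* m ℕ.* 2 ℕ.+ ℓ ℕ.* 2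
  expand = solve-∀
  collect : ∀ p m → p ℕ.* m ℕ.* 2 ℕ.+ p ℕ.* m ≡ 3 ℕ.* p ℕ.* (1 ℕ.* m)
  collect = solve-∀

q<p⇒q+ℓ/s<3/2·p : ∀ {q p ℓ s} .{{_ : NonZero s}} → q < ℕ→ℚ p → ℓ ℕ.≤ p → 2 ℕ.≤ s →
                   q + + ℓ / s < three-halves p
q<p⇒q+ℓ/s<3/2·p {q} {p} {ℓ} {suc s} q<p ℓ≤p 2≤s = begin-strict
  q + + ℓ / suc s                             <⟨ +-monoˡ-< (+ ℓ / suc s) q<p ⟩
  ℕ→ℚ p + + ℓ / suc s                         ≡⟨ /-+-/ p ℓ 0 s ⟩
  + (p ℕ.* suc s ℕ.+ ℓ ℕ.* 1) / (1 ℕ.* suc s) ≤⟨ cross-multiplied ⟩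
  + (3 ℕ.* p) / 2                             ≡⟨ three-halves≡ p ⟨
  three-halves p                              ∎
  where
  open ≤-Reasoning
  -- 1 * suc s computes to suc (s + 0)
  cross-multiplied : + (p ℕ.* suc s ℕ.+ ℓ ℕ.* 1) / (1 ℕ.* suc s) ≤ + (3 ℕ.* p) / 2
  cross-multiplied = /-mono-≤ (p ℕ.* suc s ℕ.+ ℓ ℕ.* 1) (3 ℕ.* p) (s ℕ.+ 0) 1 ([pm+ℓ]*2≤3p*m ℓ≤p 2≤s)

BudgetsBelow : (ℕ → ℚ) → List (Fin n) → Budget n → Set
BudgetsBelow g L b = ∀ z → b z < g (pos L z)

resetB-fetchList-below : ∀ {g} {b : Budget n} → g Preserves ℕ._≤_ ⟶ _≤_ → 0ℚ < g 1 →
                         BudgetsBelow g L b → BudgetsBelow g (fetchList z L) (resetB z b)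
resetB-fetchList-below {L = L} {z = z} {g} g-mono 0<g1 below w with w ≟ z
... | yes refl = subst (λ k → 0ℚ < g k) (sym (pos-fetchList-self w L)) 0<g1
... | no w≢z   = <-≤-trans (below w) (g-mono (pos-fetchList-≢ {L = L} w≢z))

below-ℕ→ℚ⇒below-three-halves : ∀ {b : Budget n} →
                               BudgetsBelow ℕ→ℚ L b → BudgetsBelow three-halves L b
below-ℕ→ℚ⇒below-three-halves {L = L} below z = <-≤-trans (below z) (ℕ→ℚ≤three-halves (pos L z))

incrB-below : ∀ {b : Budget n} {R ℓ} (x∈R : x Subset.∈ R) → BudgetsBelow ℕ→ℚ L b →
              (∀ y → y Subset.∈ R → y ≢ x → ℓ ℕ.< pos L y) →
              BudgetsBelow three-halves L (incrB R x (share R x∈R ℓ) b)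
incrB-below {x = x} {L = L} {R = R} x∈R below behind z with z ≟ x | z ∈? R
... | yes _    | _       = below-ℕ→ℚ⇒below-three-halves {L = L} below z
... | no z≢x   | yes z∈R = q<p⇒q+ℓ/s<3/2·p {{∈⇒nonZero x∈R}}
                             (below z) (ℕₚ.<⇒≤ (behind z z∈R z≢x)) (two≤∣R∣ x∈R z∈R z≢x)
... | no _     | no _    = below-ℕ→ℚ⇒below-three-halves {L = L} below z

Invariant : Phase n → List (Fin n) → Budget n → Set
Invariant idle               L b = (∀ w → w ∈ L) × BudgetsBelow ℕ→ℚ L b
Invariant (accessed R x _ ℓ) L b = (∀ w → w ∈ L) × BudgetsBelow ℕ→ℚ L b
                                 × (∀ y → y Subset.∈ R → y ≢ x → ℓ ℕ.< pos L y)
Invariant reordering         L b = (∀ w → w ∈ L) × BudgetsBelow three-halves L b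

reachable⇒invariant : ∀ {L0 : List (Fin n)} {ph L b} → L0 ↭ allFin n →
                      Reachable L0 ph L b → Invariant ph L b
reachable⇒invariant {L0 = L0} L0↭ init =
  complete , λ z → ℕ→ℚ-pos (pos L0 z) (∈⇒pos>0 (complete z))
  where
  complete : ∀ w → w ∈ L0
  complete w = ∈-resp-↭ (↭-sym L0↭) (∈-allFin w)
reachable⇒invariant L0↭ (request {L} R x x∈R first r) with reachable⇒invariant L0↭ r
... | complete , below = ∈-fetchList ∘ complete
                       , resetB-fetchList-below {L = L} ℕ→ℚ-mono-≤ (ℕ→ℚ-pos 1 ℕₚ.0<1+n) below
                       , behind
  where
  behind : ∀ y → y Subset.∈ R → y ≢ x → pos L x ℕ.< pos (fetchList x L) y
  behind y y∈R y≢x = ℕₚ.<-≤-trans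
    (ℕₚ.≤∧≢⇒< (first y y∈R) (y≢x ∘ sym ∘ pos-injective (complete x) (complete y)))
    (pos-fetchList-≢ {L = L} y≢x)
reachable⇒invariant L0↭ (budgets {L} {x∈R = x∈R} r) with reachable⇒invariant L0↭ r
... | complete , below , behind = complete , incrB-below {L = L} x∈R below behind
reachable⇒invariant L0↭ (reorder {L} z _ r) with reachable⇒invariant L0↭ r
... | complete , below = ∈-fetchList ∘ complete
                       , resetB-fetchList-below {L = L} three-halves-mono-≤
                           (<-≤-trans (ℕ→ℚ-pos 1 ℕₚ.0<1+n) (ℕ→ℚ≤three-halves 1)) below
reachable⇒invariant L0↭ (finish below r) with reachable⇒invariant L0↭ r
... | complete , _ = complete , below

invariant⇒below-three-halves : ∀ ph {b : Budget n} →
                               Invariant ph L b → BudgetsBelow three-halves L b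
invariant⇒below-three-halves {L = L} idle (_ , below) =
  below-ℕ→ℚ⇒below-three-halves {L = L} below
invariant⇒below-three-halves {L = L} (accessed _ _ _ _) (_ , below , _) =
  below-ℕ→ℚ⇒below-three-halves {L = L} below
invariant⇒below-three-halves reordering (_ , below) = below

mainTheorem6 : ∀ (n : ℕ) (L0 : List (Fin n)) → L0 ↭ allFin n →
    (∀ {L b} → Reachable L0 idle L b → ∀ z → b z < ℕ→ℚ (pos L z))
    × (∀ {ph L b} → Reachable L0 ph L b → ∀ z → b z < (+ 3 / 2) * ℕ→ℚ (pos L z))
mainTheorem6 n L0 L0↭ = proj₂ ∘ reachable⇒invariant L0↭
                      , λ {ph} r → invariant⇒below-three-halves ph (reachable⇒invariant L0↭ r)
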